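{- Let $(\Sigma,<)$ be a finite totally ordered alphabet, let $w\in\Sigma^+$, and let $(\ell_1,\ldots,\ell_h)$ be a chain for the prefix order in $\mathrm{CFL}_{in}(w)$, i.e. a block of consecutive factors of $\mathrm{CFL}_{in}(w)$ with $\ell_1\ge_p\ell_2\ge_p\cdots\ge_p\ell_h$. Then $\ell_1\cdots\ell_h$ is not an inverse Lyndon word if and only if $h>2$ and there are $i,j$ with $1\le i<j<h$ such that: (1) $\ell_1=\ell_2=\cdots=\ell_i\neq\ell_{i+1}$; (2) $\ell_{i+1}\cdots\ell_j$ is a prefix of $\ell_1$; (3) $\ell_{i+1}\cdots\ell_{j+1}$ is not a prefix of $\ell_1$; (4) $\ell_1\ll\ell_{i+1}\cdots\ell_{j+1}$; more specifically, there are words $r,s,s'\in\Sigma^*$ and letters $a,b\in\Sigma$ with $a<b$ such that $\ell_1=\ell_{i+1}\cdots\ell_j\,ras$ and $\ell_{j+1}=rbs'$.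
   Context: $x\ge_p y$ means $y$ is a prefix of $x$. Lexicographic order $\prec$ on $\Sigma^*$: $x\prec y$ if $x$ is a proper prefix of $y$, or $x=ras$, $y=rbt$ with $a,b\in\Sigma$, $a<b$. For nonempty $x,y$, $x\ll y$ means $x\prec y$ and $x$ not a proper prefix of $y$. An inverse Lyndon word is a nonempty word $u$ with $s\prec u$ for each nonempty proper suffix $s$ of $u$. Inverse order $<_{in}$: $b<_{in}a\iff a<b$; $\prec_{in}$ the induced lexicographic order. An anti-Lyndon word is a nonempty primitive word strictly smaller for $\prec_{in}$ than all its other conjugates. $\mathrm{CFL}_{in}(w)$ is the unique sequence $(\lambda_1,\ldots,\lambda_n)$ of anti-Lyndon words with $w=\lambda_1\cdots\lambda_n$ and $\lambda_1\succeq_{in}\cdots\succeq_{in}\lambda_n$. -}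

module Defs where

open import Data.Nat using (ℕ; zero; suc; _∸_)
open import Data.Fin using (Fin)
import Data.Fin as F
open import Data.List using (List; []; _∷_; _++_; concat; take; drop; replicate)
open import Data.List.Relation.Unary.All using (All)
open import Data.List.Relation.Unary.Linked using (Linked)
open import Data.Product using (Σ; ∃; _×_; _,_)
open import Data.Sum using (_⊎_)
open import Relation.Nullary using (¬_)
open import Relation.Binary.PropositionalEquality using (_≡_; _≢_)

-- A finite totally ordered alphabet Σ of size k is (up to isomorphism) Fin k
-- with its usual strict order.
Letter : ℕ → Set
Letter k = Fin k

Word : ℕ → Set
Word k = List (Letter k)

module _ {k : ℕ} where

  _<L_ : Letter k → Letter k → Set
  a <L b = a F.< b

  _<in_ : Letter k → Letter k → Set
  a <in b = b F.< a

  _≥p_ : Word k → Word k → Set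
  x ≥p y = ∃ λ z → x ≡ y ++ z

  ProperPrefix : Word k → Word k → Set
  ProperPrefix x y = ∃ λ z → z ≢ [] × y ≡ x ++ z

  Lex : (Letter k → Letter k → Set) → Word k → Word k → Set
  Lex R x y =
    ProperPrefix x y ⊎
    (Σ (Word k) λ r → Σ (Word k) λ s → Σ (Word k) λ t →
     Σ (Letter k) λ a → Σ (Letter k) λ b →
       R a b × x ≡ r ++ (a ∷ s) × y ≡ r ++ (b ∷ t))

  _≺_ : Word k → Word k → Set
  _≺_ = Lex _<L_

  _≺in_ : Word k → Word k → Set
  _≺in_ = Lex _<in_

  _⪰in_ : Word k → Word k → Set
  x ⪰in y = y ≺in x ⊎ x ≡ y

  _≪_ : Word k → Word k → Set
  x ≪ y = x ≢ [] × y ≢ [] × x ≺ y × ¬ ProperPrefix x y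

  InverseLyndon : Word k → Set
  InverseLyndon u =
    u ≢ [] ×
    (∀ (p s : Word k) → p ≢ [] → s ≢ [] → u ≡ p ++ s → s ≺ u)

  pow : Word k → ℕ → Word k
  pow v zero = []
  pow v (suc n) = v ++ pow v n

  Primitive : Word k → Set
  Primitive u = ∀ (v : Word k) (n : ℕ) → u ≡ pow v n → n ≡ 1

  AntiLyndon : Word k → Set
  AntiLyndon u =
    u ≢ [] × Primitive u ×
    (∀ (x y : Word k) → u ≡ x ++ y → y ++ x ≢ u → u ≺in (y ++ x))

  -- L = CFL_in(w)  (the sequence is unique, so this characterises it)
  IsCFLin : Word k → List (Word k) → Set
  IsCFLin w L = All AntiLyndon L × concat L ≡ w × Linked _⪰in_ L

  -- 1-indexed access ℓ_m of a list of words (default [] outside range)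
  nth : List (Word k) → ℕ → Word k
  nth [] m = []
  nth (x ∷ xs) zero = []
  nth (x ∷ xs) (suc zero) = x
  nth (x ∷ xs) (suc (suc m)) = nth xs (suc m)

  -- seg ls p q = ℓ_{p+1} ⋯ ℓ_q
  seg : List (Word k) → ℕ → ℕ → Word k
  seg ls p q = concat (take (q ∸ p) (drop p ls))

{-# OPTIONS --safe #-}
-- An anti-Lyndon word x is unbordered: a border would either make two conjugates of x
-- compare both ways under ≺in, or make x a proper power.  Hence every nonempty proper
-- suffix of x first differs from x by a smaller letter, and it follows that x ^ n v is an
-- inverse Lyndon word for every n ≥ 1 and every prefix v of x.
-- In a prefix chain ℓ₁ ≥p ℓ₂ ≥p ⋯ of anti-Lyndon words with ℓ₁ = ⋯ = ℓᵢ ≠ ℓᵢ₊₁, the product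
-- is therefore inverse Lyndon when ℓᵢ₊₁ ⋯ ℓₕ is a prefix of ℓ₁.  Otherwise let ℓⱼ₊₁ be the
-- first factor with ℓᵢ₊₁ ⋯ ℓⱼ₊₁ not a prefix of ℓ₁: the remainder of ℓ₁ after ℓᵢ₊₁ ⋯ ℓⱼ is a
-- proper suffix of ℓ₁ while ℓⱼ₊₁ is a prefix of ℓ₁, so comparing both with ℓ₁ yields the
-- letters a < b of (4).  Conversely, (4) makes the suffix ℓᵢ₊₁ ⋯ ℓₕ of the product
-- lexicographically larger than the product itself.
module Submission where

open import Defs
open import Data.Nat using (ℕ; zero; suc; _<_; _≤_; _>_; _+_; z≤n; s≤s)
open import Data.Nat.Properties
  using (suc-injective; +-suc; +-comm; +-cancelʳ-≡; +-monoʳ-<; m<m+n; ≤-trans; ≤-<-trans; <⇒≤; <⇒≱; 0≢1+n)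
open import Data.Fin using (Fin)
import Data.Fin as F
import Data.Fin.Properties as FP
open import Data.List using (List; []; _∷_; _++_; concat; length; take; replicate)
open import Data.List.Properties
  using (∷-injective; ∷-injectiveˡ; ∷-injectiveʳ; ++-assoc; ++-identityʳ; ++-cancelˡ; ++-conicalˡ;
         ++-identityˡ-unique; ++-identityʳ-unique; length-++; length-++-≤ˡ; length-++-≤ʳ; concat-++; ≡-dec)
open import Data.List.Relation.Unary.All using (All; []; _∷_)
import Data.List.Relation.Unary.All as All
open import Data.List.Relation.Unary.All.Properties using (++⁻ˡ; ++⁻ʳ)
open import Data.List.Relation.Unary.AllPairs using (_∷_)
open import Data.List.Relation.Unary.Linked using (Linked; []; [-]; _∷_)
open import Data.List.Relation.Unary.Linked.Properties using (Linked⇒AllPairs)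
open import Data.List.Relation.Binary.Prefix.Heterogeneous.Properties using (prefix?)
open import Data.List.Relation.Binary.Prefix.Propositional.Properties using (Prefix-as-∣ˡ; ∣ˡ-as-Prefix)
import Algebra.Definitions.RawMagma as RawMagma
open import Data.Product using (Σ; ∃; ∃₂; _×_; _,_; proj₁; proj₂)
open import Data.Sum using (_⊎_; inj₁; inj₂)
open import Data.Empty using (⊥-elim)
open import Function using (_∘_; flip)
open import Function.Bundles using (_⇔_; mk⇔)
open import Induction.WellFounded using (Acc; acc)
open import Data.Nat.Induction using (<-wellFounded)
open import Relation.Nullary using (¬_; Dec; yes; no)
import Relation.Nullary.Decidable as Dec
open import Relation.Unary using (Decidable)
open import Relation.Binary using (Asymmetric)
open import Relation.Binary.PropositionalEquality
  using (_≡_; _≢_; refl; sym; trans; cong; cong₂; subst; subst₂; ≢-sym; module ≡-Reasoning)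
open ≡-Reasoning

module _ {A : Set} where

  ++-split : ∀ (a b c d : List A) → a ++ b ≡ c ++ d →
    (∃ λ m → c ≡ a ++ m × b ≡ m ++ d) ⊎ (∃ λ m → m ≢ [] × a ≡ c ++ m × d ≡ m ++ b)
  ++-split []      b c       d eq = inj₁ (c , refl , eq)
  ++-split (x ∷ a) b []      d eq = inj₂ (x ∷ a , (λ ()) , refl , sym eq)
  ++-split (x ∷ a) b (y ∷ c) d eq with ∷-injective eq
  ... | refl , eq′ with ++-split a b c d eq′
  ... | inj₁ (m , c≡am , b≡md)        = inj₁ (m , cong (x ∷_) c≡am , b≡md)
  ... | inj₂ (m , m≢[] , a≡cm , d≡mb) = inj₂ (m , m≢[] , cong (x ∷_) a≡cm , d≡mb)

  ++-∷-≢[] : ∀ (u : List A) {c w} → u ++ c ∷ w ≢ []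
  ++-∷-≢[] []      ()
  ++-∷-≢[] (_ ∷ _) ()

  length-suffix-< : ∀ (p t : List A) → p ≢ [] → length t < length (p ++ t)
  length-suffix-< []      t p≢[] = ⊥-elim (p≢[] refl)
  length-suffix-< (_ ∷ p) t _    = s≤s (length-++-≤ʳ t {p})

  prefix-of-same-length : ∀ (x : List A) {y m} → y ≡ x ++ m → length x ≡ length y → x ≡ y
  prefix-of-same-length []      {[]}    _ _   = refl
  prefix-of-same-length []      {_ ∷ _} _ ()
  prefix-of-same-length (a ∷ x) {[]}    () _
  prefix-of-same-length (a ∷ x) {b ∷ y} e len =
    cong₂ _∷_ (sym (∷-injectiveˡ e)) (prefix-of-same-length x (∷-injectiveʳ e) (suc-injective len))

  divergence-unique : ∀ (C C′ : List A) {c d c′ d′ X Y X′ Y′} → c ≢ d → c′ ≢ d′ →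
    C ++ c ∷ X ≡ C′ ++ c′ ∷ X′ → C ++ d ∷ Y ≡ C′ ++ d′ ∷ Y′ → c ≡ c′ × d ≡ d′
  divergence-unique []      []       _   _     e₁ e₂ = ∷-injectiveˡ e₁ , ∷-injectiveˡ e₂
  divergence-unique []      (_ ∷ C′) c≢d _     e₁ e₂ =
    ⊥-elim (c≢d (trans (∷-injectiveˡ e₁) (sym (∷-injectiveˡ e₂))))
  divergence-unique (_ ∷ C) []       _   c′≢d′ e₁ e₂ =
    ⊥-elim (c′≢d′ (trans (sym (∷-injectiveˡ e₁)) (∷-injectiveˡ e₂)))
  divergence-unique (_ ∷ C) (_ ∷ C′) c≢d c′≢d′ e₁ e₂ =
    divergence-unique C C′ c≢d c′≢d′ (∷-injectiveʳ e₁) (∷-injectiveʳ e₂)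

  first-violation : ∀ (P : List A → Set) → Decidable P → P [] → ∀ vs → ¬ P vs →
    ∃ λ ws → ∃₂ λ y zs → vs ≡ ws ++ y ∷ zs × P ws × ¬ P (ws ++ y ∷ [])
  first-violation P P? P[] []       ¬Pvs = ⊥-elim (¬Pvs P[])
  first-violation P P? P[] (y ∷ vs) ¬Pvs with P? (y ∷ [])
  ... | no ¬Py = [] , y , vs , refl , P[] , ¬Py
  ... | yes Py with first-violation (P ∘ (y ∷_)) (P? ∘ (y ∷_)) Py vs ¬Pvs
  ... | ws , y′ , zs , refl , Pws , ¬Pws′ = y ∷ ws , y′ , zs , refl , Pws , ¬Pws′

module _ {k : ℕ} where

  private
    W : Set
    W = Word k

  Diverge : (Letter k → Letter k → Set) → W → W → Set
  Diverge R x y =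
    Σ W λ r → Σ W λ s → Σ W λ t → Σ (Letter k) λ a → Σ (Letter k) λ b →
      R a b × x ≡ r ++ a ∷ s × y ≡ r ++ b ∷ t

  module _ {R : Letter k → Letter k → Set} where

    Diverge-map : ∀ {R′ x y} → (∀ {a b} → R a b → R′ a b) → Diverge R x y → Diverge R′ x y
    Diverge-map f (r , s , t , a , b , Rab , x≡ , y≡) = r , s , t , a , b , f Rab , x≡ , y≡

    Diverge-flip : ∀ {x y} → Diverge R x y → Diverge (flip R) y x
    Diverge-flip (r , s , t , a , b , Rab , x≡ , y≡) = r , t , s , b , a , Rab , y≡ , x≡

    Diverge-++ʳ : ∀ {x y} u v → Diverge R x y → Diverge R (x ++ u) (y ++ v)
    Diverge-++ʳ u v (r , s , t , a , b , Rab , x≡ , y≡) =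
      r , s ++ u , t ++ v , a , b , Rab ,
      trans (cong (_++ u) x≡) (++-assoc r (a ∷ s) u) , trans (cong (_++ v) y≡) (++-assoc r (b ∷ t) v)

    Diverge-++ˡ : ∀ {x y} u → Diverge R x y → Diverge R (u ++ x) (u ++ y)
    Diverge-++ˡ u (r , s , t , a , b , Rab , x≡ , y≡) =
      u ++ r , s , t , a , b , Rab ,
      trans (cong (u ++_) x≡) (sym (++-assoc u r (a ∷ s))) ,
      trans (cong (u ++_) y≡) (sym (++-assoc u r (b ∷ t)))

    Diverge⇒≢[] : ∀ {x y} → Diverge R x y → x ≢ [] × y ≢ []
    Diverge⇒≢[] (r , _ , _ , _ , _ , _ , refl , refl) = ++-∷-≢[] r , ++-∷-≢[] r

    Diverge⇒Lex-prefix : ∀ s {z y} → Diverge R (s ++ z) y → Lex R s y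
    Diverge⇒Lex-prefix s {z} (r , S , T , a , b , Rab , sz≡ , y≡) with ++-split s z r (a ∷ S) sz≡
    ... | inj₁ (m , r≡sm , _) =
      inj₁ (m ++ b ∷ T , ++-∷-≢[] m , trans y≡ (trans (cong (_++ b ∷ T) r≡sm) (++-assoc s m (b ∷ T))))
    ... | inj₂ ([] , m≢[] , _ , _) = ⊥-elim (m≢[] refl)
    ... | inj₂ (a′ ∷ m , _ , s≡ , a∷S≡) =
      inj₂ (r , m , T , a′ , b , subst (λ c → R c b) (∷-injectiveˡ a∷S≡) Rab , s≡ , y≡)

    Lex-extendʳ : ∀ {s y z} → z ≥p y → Lex R s y → Lex R s z
    Lex-extendʳ {s} (m , z≡ym) (inj₁ (u , u≢[] , y≡su)) =
      inj₁ (u ++ m , u≢[] ∘ ++-conicalˡ u m , trans z≡ym (trans (cong (_++ m) y≡su) (++-assoc s u m)))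
    Lex-extendʳ (m , z≡ym) (inj₂ (r , S , T , a , b , Rab , s≡ , y≡)) =
      inj₂ (r , S , T ++ m , a , b , Rab , s≡ , trans z≡ym (trans (cong (_++ m) y≡) (++-assoc r (b ∷ T) m)))

  Diverge⇒¬≥p : ∀ {x y} → Diverge _≢_ x y → ¬ (y ≥p x)
  Diverge⇒¬≥p (C , X , Y , c , d , c≢d , refl , y≡) (m , y≡xm) =
    c≢d (sym (∷-injectiveˡ (++-cancelˡ C _ _ (trans (sym y≡) (trans y≡xm (++-assoc C (c ∷ X) m))))))

  Lex-at-divergence : ∀ {R : Letter k → Letter k → Set} → (∀ {a b} → R a b → a ≢ b) →
    ∀ {y z} → Lex R y z → ∀ C {c d X Y} → c ≢ d → y ≡ C ++ c ∷ X → z ≡ C ++ d ∷ Y → R c d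
  Lex-at-divergence _ (inj₁ (m , _ , z≡ym)) C c≢d y≡ z≡ =
    ⊥-elim (Diverge⇒¬≥p (C , _ , _ , _ , _ , c≢d , y≡ , z≡) (m , z≡ym))
  Lex-at-divergence R⇒≢ (inj₂ (r , s , t , a , b , Rab , y≡ , z≡)) C c≢d y≡′ z≡′
    with divergence-unique C r c≢d (R⇒≢ Rab) (trans (sym y≡′) y≡) (trans (sym z≡′) z≡)
  ... | refl , refl = Rab

  Diverge⇒¬Lex : ∀ {R : Letter k → Letter k → Set} → Asymmetric R → ∀ {x y} → Diverge R x y → ¬ Lex R y x
  Diverge⇒¬Lex {R} asym (C , X , Y , a , b , Rab , x≡ , y≡) y<x =
    asym Rab (Lex-at-divergence R⇒≢ y<x C (≢-sym (R⇒≢ Rab)) y≡ x≡)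
    where
      R⇒≢ : ∀ {a b} → R a b → a ≢ b
      R⇒≢ Rab refl = asym Rab Rab

  <L⇒≢ : ∀ {a b : Letter k} → a <L b → a ≢ b
  <L⇒≢ a<b refl = FP.<-irrefl refl a<b

  <in⇒≢ : ∀ {a b : Letter k} → a <in b → a ≢ b
  <in⇒≢ b<a refl = FP.<-irrefl refl b<a

  Diverge⇒≪ : ∀ {x y} → Diverge _<L_ x y → x ≪ y
  Diverge⇒≪ d =
    proj₁ (Diverge⇒≢[] d) , proj₂ (Diverge⇒≢[] d) , inj₂ d ,
    λ (z , _ , y≡xz) → Diverge⇒¬≥p (Diverge-map <L⇒≢ d) (z , y≡xz)

  data Comparison (y z : W) : Set where
    prefix    : z ≥p y → Comparison y z
    extension : y ≥p z → Comparison y z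
    diverge   : Diverge _≢_ y z → Comparison y z

  compareWords : ∀ y z → Comparison y z
  compareWords []      z       = prefix (z , refl)
  compareWords (a ∷ y) []      = extension (a ∷ y , refl)
  compareWords (a ∷ y) (b ∷ z) with a F.≟ b
  ... | no a≢b = diverge ([] , y , z , a , b , a≢b , refl , refl)
  ... | yes refl with compareWords y z
  ... | prefix (m , z≡ym)    = prefix (m , cong (a ∷_) z≡ym)
  ... | extension (m , y≡zm) = extension (m , cong (a ∷_) y≡zm)
  ... | diverge d            = diverge (Diverge-++ˡ (a ∷ []) d)

  ≥p-trans : ∀ {x y w : W} → x ≥p y → y ≥p w → x ≥p w
  ≥p-trans {w = w} (z₁ , x≡yz₁) (z₂ , y≡wz₂) =
    z₂ ++ z₁ , trans x≡yz₁ (trans (cong (_++ z₁) y≡wz₂) (++-assoc w z₂ z₁))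

  _≥p?_ : ∀ (x y : W) → Dec (x ≥p y)
  x ≥p? y = Dec.map′ (λ y≤x → let z RawMagma., yz≡x = Prefix-as-∣ˡ y≤x in z , sym yz≡x)
                     (λ (z , x≡yz) → ∣ˡ-as-Prefix (z RawMagma., sym x≡yz))
                     (prefix? F._≟_ y x)

  ≥p⇒ProperPrefix : ∀ {x y : W} → x ≥p y → y ≢ x → ProperPrefix y x
  ≥p⇒ProperPrefix {y = y} ([] , x≡y[]) y≢x = ⊥-elim (y≢x (sym (trans x≡y[] (++-identityʳ y))))
  ≥p⇒ProperPrefix (z@(_ ∷ _) , x≡yz) _  = z , (λ ()) , x≡yz

  properPrefix? : ∀ (y x : W) → Dec (ProperPrefix y x)
  properPrefix? y x with x ≥p? y | ≡-dec F._≟_ y x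
  ... | no ¬x≥py  | _       = no λ (z , _ , x≡yz) → ¬x≥py (z , x≡yz)
  ... | yes _     | yes refl = no λ (z , z≢[] , y≡yz) → z≢[] (++-identityʳ-unique y y≡yz)
  ... | yes x≥py  | no y≢x  = yes (≥p⇒ProperPrefix x≥py y≢x)

  pow-+ : ∀ (v : W) a b → pow v a ++ pow v b ≡ pow v (a + b)
  pow-+ v zero    b = refl
  pow-+ v (suc a) b = trans (++-assoc v (pow v a) (pow v b)) (cong (v ++_) (pow-+ v a b))

  commuting⇒powers : ∀ (p t : W) → Acc _<_ (length p + length t) → p ++ t ≡ t ++ p →
    ∃ λ v → ∃₂ λ a b → p ≡ pow v a × t ≡ pow v b
  commuting⇒powers [] t _ _ = t , 0 , 1 , refl , sym (++-identityʳ t)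
  commuting⇒powers p@(_ ∷ _) [] _ _ = p , 1 , 0 , sym (++-identityʳ p) , refl
  commuting⇒powers p@(_ ∷ _) t@(_ ∷ _) (acc smaller) pt≡tp with ++-split p t t p pt≡tp
  ... | inj₁ (m , t≡pm , t≡mp) with commuting⇒powers p m (smaller shorter) (trans (sym t≡pm) t≡mp)
    where
      shorter : length p + length m < length p + length t
      shorter = +-monoʳ-< (length p)
                  (subst (λ u → length m < length u) (sym t≡pm) (length-suffix-< p m (λ ())))
  ... | v , a , b , p≡ , m≡ = v , a , a + b , p≡ , trans t≡pm (trans (cong₂ _++_ p≡ m≡) (pow-+ v a b))
  commuting⇒powers p@(_ ∷ _) t@(_ ∷ _) (acc smaller) pt≡tp | inj₂ (m , _ , p≡tm , p≡mt)
    with commuting⇒powers t m (smaller shorter) (trans (sym p≡tm) p≡mt)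
    where
      shorter : length t + length m < length p + length t
      shorter = subst (_< length p + length t) (trans (cong length p≡tm) (length-++ t))
                      (m<m+n (length p) (s≤s z≤n))
  ... | v , a , b , t≡ , m≡ = v , a + b , a , trans p≡tm (trans (cong₂ _++_ t≡ m≡) (pow-+ v a b)) , t≡

  commuting⇒¬Primitive : ∀ {p t : W} → p ≢ [] → t ≢ [] → p ++ t ≡ t ++ p → ¬ Primitive (p ++ t)
  commuting⇒¬Primitive {p} {t} p≢[] t≢[] pt≡tp primitivity
    with commuting⇒powers p t (<-wellFounded _) pt≡tp
  ... | v , zero  , _     , p≡ , _  = p≢[] p≡
  ... | v , suc _ , zero  , _  , t≡ = t≢[] t≡
  ... | v , suc a , suc b , p≡ , t≡ =
    0≢1+n (sym (trans (sym (+-suc a b)) (suc-injective (primitivity v (suc a + suc b) pt≡pow))))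
    where
      pt≡pow : p ++ t ≡ pow v (suc a + suc b)
      pt≡pow = trans (cong₂ _++_ p≡ t≡) (pow-+ v (suc a) (suc b))

  antiLyndon-conjugate : ∀ {x} → AntiLyndon x → ∀ u v → x ≡ u ++ v →
    ∀ C {c d X Y} → c ≢ d → v ++ u ≡ C ++ c ∷ X → x ≡ C ++ d ∷ Y → c <L d
  antiLyndon-conjugate (_ , _ , least) u v x≡uv C c≢d vu≡ x≡ =
    Lex-at-divergence <in⇒≢ (least u v x≡uv vu≢x) C (≢-sym c≢d) x≡ vu≡
    where
      vu≢x : v ++ u ≢ _
      vu≢x vu≡x = c≢d (∷-injectiveˡ (++-cancelˡ C _ _ (trans (sym vu≡) (trans vu≡x x≡))))

  antiLyndon-unbordered : ∀ {x p t} → AntiLyndon x → p ≢ [] → t ≢ [] → x ≡ p ++ t → ¬ (x ≥p t)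
  antiLyndon-unbordered {p = p} {t} al@(_ , primitivity , _) p≢[] t≢[] x≡pt (z , x≡tz) =
    commuting⇒¬Primitive p≢[] t≢[] pt≡tp (subst Primitive x≡pt primitivity)
    where
      same-length : length p ≡ length z
      same-length = +-cancelʳ-≡ (length t) (length p) (length z) (begin
        length p + length t  ≡⟨ length-++ p ⟨
        length (p ++ t)      ≡⟨ cong length (trans (sym x≡pt) x≡tz) ⟩
        length (t ++ z)      ≡⟨ length-++ t ⟩
        length t + length z  ≡⟨ +-comm (length t) (length z) ⟩
        length z + length t  ∎)

      p≡z : p ≡ z
      p≡z with compareWords p z
      ... | prefix (m , z≡pm)    = prefix-of-same-length p z≡pm same-length
      ... | extension (m , p≡zm) = sym (prefix-of-same-length z p≡zm (sym same-length))
      ... | diverge (C , P , Z , e , f , e≢f , p≡ , z≡) = ⊥-elim (FP.<-asym e<f f<e)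
        where
          e<f : e <L f
          e<f = antiLyndon-conjugate al p t x≡pt (t ++ C) e≢f
                  (trans (cong (t ++_) p≡) (sym (++-assoc t C (e ∷ P))))
                  (trans x≡tz (trans (cong (t ++_) z≡) (sym (++-assoc t C (f ∷ Z)))))
          f<e : f <L e
          f<e = antiLyndon-conjugate al t z x≡tz C (≢-sym e≢f)
                  (trans (cong (_++ t) z≡) (++-assoc C (f ∷ Z) t))
                  (trans x≡pt (trans (cong (_++ t) p≡) (++-assoc C (e ∷ P) t)))

      pt≡tp : p ++ t ≡ t ++ p
      pt≡tp = trans (sym x≡pt) (trans x≡tz (cong (t ++_) (sym p≡z)))

  antiLyndon-suffix-diverges : ∀ {x p t} → AntiLyndon x → p ≢ [] → t ≢ [] → x ≡ p ++ t → Diverge _<L_ t x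
  antiLyndon-suffix-diverges {x} {p} {t} al p≢[] t≢[] x≡pt with compareWords t x
  ... | prefix x≥pt = ⊥-elim (antiLyndon-unbordered al p≢[] t≢[] x≡pt x≥pt)
  ... | extension (m , t≡xm) =
    ⊥-elim (<⇒≱ (subst (λ u → length t < length u) (sym x≡pt) (length-suffix-< p t p≢[]))
                 (subst (λ u → length x ≤ length u) (sym t≡xm) (length-++-≤ˡ x)))
  ... | diverge (C , X , Y , c , d , c≢d , t≡ , x≡) =
    C , X , Y , c , d ,
    antiLyndon-conjugate al p t x≡pt C c≢d (trans (cong (_++ p) t≡) (++-assoc C (c ∷ X) p)) x≡ ,
    t≡ , x≡

  antiLyndon-prefix-diverges : ∀ {x P x₁ y} → AntiLyndon x → P ≢ [] → x₁ ≢ [] → x ≡ P ++ x₁ →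
    x ≥p y → ¬ (x ≥p (P ++ y)) → Diverge _<L_ x₁ y
  antiLyndon-prefix-diverges {P = P} {x₁} {y} al P≢[] x₁≢[] x≡ (z , x≡yz) ¬x≥pPy with compareWords x₁ y
  ... | prefix (m , y≡x₁m) =
    ⊥-elim (antiLyndon-unbordered al P≢[] x₁≢[] x≡
             (m ++ z , trans x≡yz (trans (cong (_++ z) y≡x₁m) (++-assoc x₁ m z))))
  ... | extension (m , x₁≡ym) =
    ⊥-elim (¬x≥pPy (m , trans x≡ (trans (cong (P ++_) x₁≡ym) (sym (++-assoc P y m)))))
  ... | diverge (C , X , Y , c , d , c≢d , x₁≡ , y≡)
    with antiLyndon-suffix-diverges al P≢[] x₁≢[] x≡
  ... | C′ , X′ , Y′ , c′ , d′ , c′<d′ , x₁≡′ , x≡′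
    with divergence-unique C C′ c≢d (<L⇒≢ c′<d′) (trans (sym x₁≡) x₁≡′)
           (trans (sym (trans x≡yz (trans (cong (_++ z) y≡) (++-assoc C (d ∷ Y) z)))) x≡′)
  ... | refl , refl = C , X , Y , c , d , c′<d′ , x₁≡ , y≡

  copies-then-prefix-inverseLyndon : ∀ {x} (vs : List W) → AntiLyndon x → x ≥p concat vs →
    ∀ n → InverseLyndon (concat (replicate (suc n) x ++ vs))
  copies-then-prefix-inverseLyndon {x} vs al (z , x≡vz) n = proj₁ al ∘ ++-conicalˡ x (q n) , suffix≺ n
    where
      q : ℕ → W
      q n = concat (replicate n x ++ vs)

      q-prefix : ∀ n → (x ++ q n) ≥p q n
      q-prefix zero    =
        z ++ concat vs , trans (cong (_++ concat vs) x≡vz) (++-assoc (concat vs) z (concat vs))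
      q-prefix (suc n) with q-prefix n
      ... | m , e = m , trans (cong (x ++_) e) (sym (++-assoc x (q n) m))

      q≺ : ∀ n → q n ≺ (x ++ q n)
      q≺ n with q-prefix n
      ... | []        , e = ⊥-elim (proj₁ al (++-identityˡ-unique x (sym (trans e (++-identityʳ (q n))))))
      ... | m@(_ ∷ _) , e = inj₁ (m , (λ ()) , e)

      -- A proper suffix of x ++ q n starts inside x (and then diverges downwards from x),
      -- or is q n (a proper prefix), or is a proper suffix of q n (handled by induction).
      suffix≺ : ∀ n p s → p ≢ [] → s ≢ [] → q (suc n) ≡ p ++ s → s ≺ q (suc n)
      inner-suffix≺ : ∀ n m s → m ≢ [] → s ≢ [] → q n ≡ m ++ s → s ≺ q (suc n)

      suffix≺ n p s p≢[] s≢[] eq with ++-split x (q n) p s eq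
      ... | inj₂ (m , m≢[] , x≡pm , s≡mq) =
        subst (_≺ q (suc n)) (sym s≡mq)
          (inj₂ (Diverge-++ʳ (q n) (q n) (antiLyndon-suffix-diverges al p≢[] m≢[] x≡pm)))
      ... | inj₁ ([]        , _ , q≡s)  = subst (_≺ q (suc n)) q≡s (q≺ n)
      ... | inj₁ (m@(_ ∷ _) , _ , q≡ms) = inner-suffix≺ n m s (λ ()) s≢[] q≡ms

      inner-suffix≺ zero m s m≢[] s≢[] v≡ms =
        Lex-extendʳ (concat vs , refl)
          (Diverge⇒Lex-prefix s (antiLyndon-suffix-diverges al m≢[] (s≢[] ∘ ++-conicalˡ s z)
            (trans x≡vz (trans (cong (_++ z) v≡ms) (++-assoc m s z)))))
      inner-suffix≺ (suc n) m s m≢[] s≢[] q≡ms =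
        Lex-extendʳ (q-prefix (suc n)) (suffix≺ n m s m≢[] s≢[] q≡ms)

  first-overflow : ∀ {x y vs} → AntiLyndon x → All (λ u → AntiLyndon u × x ≥p u) (y ∷ vs) → y ≢ x →
    ¬ (x ≥p concat (y ∷ vs)) →
    ∃ λ ws → ∃₂ λ y′ zs → ∃ λ x₁ → vs ≡ ws ++ y′ ∷ zs × x ≡ concat (y ∷ ws) ++ x₁ × Diverge _<L_ x₁ y′
  first-overflow {x} {y} {vs} al ((al-y , x≥py) ∷ props) y≢x ¬x≥p
    with first-violation (λ ws → ProperPrefix (y ++ concat ws) x) (λ ws → properPrefix? (y ++ concat ws) x)
                         y<x vs (λ (z , _ , x≡) → ¬x≥p (z , x≡))
    where
      y<x : ProperPrefix (y ++ []) x
      y<x = subst (λ u → ProperPrefix u x) (sym (++-identityʳ y)) (≥p⇒ProperPrefix x≥py y≢x)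
  ... | ws , y′ , zs , refl , (x₁ , x₁≢[] , x≡) , ¬P with All.head (++⁻ʳ ws props)
  ... | al-y′ , x≥py′ =
    ws , y′ , zs , x₁ , refl , x≡ , antiLyndon-prefix-diverges al P≢[] x₁≢[] x≡ x≥py′ ¬x≥pPy′
    where
      P = y ++ concat ws
      P≢[] : P ≢ []
      P≢[] = proj₁ al-y ∘ ++-conicalˡ y (concat ws)
      Py′≡ : P ++ y′ ≡ y ++ concat (ws ++ y′ ∷ [])
      Py′≡ = trans (++-assoc y (concat ws) y′)
               (cong (y ++_) (trans (cong (concat ws ++_) (sym (++-identityʳ y′))) (concat-++ ws (y′ ∷ []))))
      ¬x≥pPy′ : ¬ (x ≥p (P ++ y′))
      ¬x≥pPy′ x≥p = ¬P (subst (λ u → ProperPrefix u x) Py′≡ (≥p⇒ProperPrefix x≥p y′-not-border))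
        where
          y′-not-border : P ++ y′ ≢ x
          y′-not-border e = antiLyndon-unbordered al P≢[] (proj₁ al-y′) (sym e) x≥py′

  data LeadingCopies (x : W) : List W → Set where
    only-copies : ∀ n → LeadingCopies x (replicate n x ++ [])
    copies-then : ∀ n {y} ys → y ≢ x → LeadingCopies x (replicate n x ++ y ∷ ys)

  leadingCopies : ∀ x ls → LeadingCopies x ls
  leadingCopies x []       = only-copies 0
  leadingCopies x (y ∷ ls) with ≡-dec F._≟_ y x
  ... | no y≢x = copies-then 0 ls y≢x
  ... | yes refl with leadingCopies x ls
  ... | only-copies n          = only-copies (suc n)
  ... | copies-then n ys y′≢x  = copies-then (suc n) ys y′≢x

  nth-replicate : ∀ (x : W) n T m → 1 ≤ m → m ≤ length (replicate n x) → nth (replicate n x ++ T) m ≡ x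
  nth-replicate x (suc n) T (suc zero)    _ _          = refl
  nth-replicate x (suc n) T (suc (suc m)) _ (s≤s m<n) = nth-replicate x n T (suc m) (s≤s z≤n) m<n

  nth-block : ∀ (as bs : List W) c cs → nth (as ++ bs ++ c ∷ cs) (suc (length as + length bs)) ≡ c
  nth-block []       []       c cs = refl
  nth-block []       (b ∷ bs) c cs = nth-block [] bs c cs
  nth-block (a ∷ as) bs       c cs = nth-block as bs c cs

  seg-block : ∀ (as bs cs : List W) → seg (as ++ bs ++ cs) (length as) (length as + length bs) ≡ concat bs
  seg-block []       []       cs = refl
  seg-block []       (b ∷ bs) cs = cong (b ++_) (seg-block [] bs cs)
  seg-block (a ∷ as) bs       cs = seg-block as bs cs

  seg-block-suc : ∀ (as bs : List W) c cs →
    seg (as ++ bs ++ c ∷ cs) (length as) (suc (length as + length bs)) ≡ concat bs ++ c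
  seg-block-suc []       []       c cs = ++-identityʳ c
  seg-block-suc []       (b ∷ bs) c cs =
    trans (cong (b ++_) (seg-block-suc [] bs c cs)) (sym (++-assoc b (concat bs) c))
  seg-block-suc (a ∷ as) bs       c cs = seg-block-suc as bs c cs

  length-block : ∀ (as bs : List W) c cs → length as + length bs < length (as ++ bs ++ c ∷ cs)
  length-block []       []       c cs = s≤s z≤n
  length-block []       (b ∷ bs) c cs = s≤s (length-block [] bs c cs)
  length-block (a ∷ as) bs       c cs = s≤s (length-block as bs c cs)

  concat-segments : ∀ (ls : List W) i j → i ≤ j → j < length ls →
    ∃ λ T → concat ls ≡ concat (take i ls) ++ seg ls i j ++ nth ls (suc j) ++ T
  concat-segments (ℓ ∷ ls) zero    zero    _         _         = concat ls , refl
  concat-segments (ℓ ∷ ls) zero    (suc j) _         (s≤s j<l) with concat-segments ls zero j z≤n j<l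
  ... | T , e = T , trans (cong (ℓ ++_) e) (sym (++-assoc ℓ (seg ls zero j) _))
  concat-segments (ℓ ∷ ls) (suc i) (suc j) (s≤s i≤j) (s≤s j<l) with concat-segments ls i j i≤j j<l
  ... | T , e = T , trans (cong (ℓ ++_) e) (sym (++-assoc ℓ (concat (take i ls)) _))

  Linked-of-nth : ∀ {R : W → W → Set} (ls : List W) →
    (∀ m → 1 ≤ m → m < length ls → R (nth ls m) (nth ls (suc m))) → Linked R ls
  Linked-of-nth []           _    = []
  Linked-of-nth (x ∷ [])     _    = [-]
  Linked-of-nth {R} (x ∷ y ∷ ls) step = step 1 (s≤s z≤n) (s≤s (s≤s z≤n)) ∷ Linked-of-nth (y ∷ ls) step′
    where
      step′ : ∀ m → 1 ≤ m → m < length (y ∷ ls) → R (nth (y ∷ ls) m) (nth (y ∷ ls) (suc m))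
      step′ (suc m) _ m<l = step (suc (suc m)) (s≤s z≤n) (s≤s m<l)

  prefix-chain⇒prefixes : ∀ {x rest} → Linked _≥p_ (x ∷ rest) → All (x ≥p_) rest
  prefix-chain⇒prefixes chain with Linked⇒AllPairs ≥p-trans chain
  ... | x≥p-rest ∷ _ = x≥p-rest

  Obstruction : List W → Set
  Obstruction ls =
    length ls > 2 ×
    Σ ℕ λ i → Σ ℕ λ j →
      1 ≤ i × i < j × j < length ls ×
      (∀ (m : ℕ) → 1 ≤ m → m ≤ i → nth ls m ≡ nth ls 1) ×
      nth ls 1 ≢ nth ls (suc i) ×
      nth ls 1 ≥p seg ls i j ×
      ¬ (nth ls 1 ≥p seg ls i (suc j)) ×
      nth ls 1 ≪ seg ls i (suc j) ×
      (Σ W λ r → Σ W λ s → Σ W λ s′ → Σ (Fin k) λ a → Σ (Fin k) λ b →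
        a <L b × nth ls 1 ≡ seg ls i j ++ r ++ (a ∷ s) × nth ls (suc j) ≡ r ++ (b ∷ s′))

  obstruction-intro : ∀ n {x y x₁ y′ : W} ws zs → y ≢ x → x ≡ concat (y ∷ ws) ++ x₁ → Diverge _<L_ x₁ y′ →
    Obstruction (replicate (suc n) x ++ (y ∷ ws) ++ y′ ∷ zs)
  obstruction-intro n {x} {y} {x₁} {y′} ws zs y≢x x≡ d@(r , s , s′ , a , b , a<b , x₁≡ , y′≡) =
    ≤-<-trans (≤-trans (s≤s (s≤s z≤n)) i<j) j<length , i , j , s≤s z≤n , i<j , j<length ,
    nth-replicate x (suc n) T ,
    (λ x≡y → y≢x (sym (trans x≡y (nth-block [] R y (ws ++ y′ ∷ zs))))) ,
    (x₁ , trans x≡ (cong (_++ x₁) (sym seg-ij))) ,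
    Diverge⇒¬≥p (Diverge-map (≢-sym ∘ <L⇒≢) (Diverge-flip diverge-seg)) ,
    Diverge⇒≪ diverge-seg ,
    r , s , s′ , a , b , a<b , trans x≡ (cong₂ _++_ (sym seg-ij) x₁≡) , trans (nth-block R B y′ zs) y′≡
    where
      R = replicate (suc n) x
      B = y ∷ ws
      T = B ++ y′ ∷ zs
      i = length R
      j = length R + length B
      i<j : i < j
      i<j = m<m+n i (s≤s z≤n)
      j<length : j < length (R ++ T)
      j<length = length-block R B y′ zs
      seg-ij : seg (R ++ T) i j ≡ concat B
      seg-ij = seg-block R B (y′ ∷ zs)
      diverge-seg : Diverge _<L_ x (seg (R ++ T) i (suc j))
      diverge-seg = subst₂ (Diverge _<L_) (sym x≡) (sym (seg-block-suc R B y′ zs)) (Diverge-++ˡ (concat B) d)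

  obstruction-of-¬inverseLyndon : ∀ ls → ls ≢ [] → All AntiLyndon ls → Linked _≥p_ ls →
    ¬ InverseLyndon (concat ls) → Obstruction ls
  obstruction-of-¬inverseLyndon []         ls≢[] _ _ _ = ⊥-elim (ls≢[] refl)
  obstruction-of-¬inverseLyndon (x ∷ rest) _ (al ∷ als) chain ¬IL with leadingCopies x rest
  ... | only-copies n = ⊥-elim (¬IL (copies-then-prefix-inverseLyndon [] al (x , refl) n))
  ... | copies-then n {y} vs y≢x
    with first-overflow al (++⁻ʳ (replicate n x) (All.zip (als , prefix-chain⇒prefixes chain))) y≢x
                  (λ x≥p → ¬IL (copies-then-prefix-inverseLyndon (y ∷ vs) al x≥p n))
  ... | ws , y′ , zs , x₁ , refl , x≡ , d = obstruction-intro n ws zs y≢x x≡ d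

  ¬inverseLyndon-of-obstruction : ∀ ls → Obstruction ls → ¬ InverseLyndon (concat ls)
  ¬inverseLyndon-of-obstruction [] (_ , _ , _ , _ , _ , () , _)
  ¬inverseLyndon-of-obstruction (x ∷ rest) (_ , zero , _ , () , _)
  ¬inverseLyndon-of-obstruction ls@(x ∷ rest)
    (_ , suc i , j , _ , i<j , j<l , _ , _ , _ , _ , (x≢[] , _) , r , s , s′ , a , b , a<b , x≡ , ℓ≡)
    (_ , suffix≺) with concat-segments ls (suc i) j (<⇒≤ i<j) j<l
  ... | T , ls≡ = Diverge⇒¬Lex FP.<-asym ls-diverges
                    (suffix≺ (x ++ Q) S (x≢[] ∘ ++-conicalˡ x Q) (proj₂ (Diverge⇒≢[] ls-diverges)) ls≡)
    where
      G = seg ls (suc i) j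
      Q = concat (take i rest)
      S = G ++ nth ls (suc j) ++ T
      ls≡′ : concat ls ≡ G ++ (r ++ a ∷ s) ++ Q ++ S
      ls≡′ = begin
        concat ls                   ≡⟨ ls≡ ⟩
        (x ++ Q) ++ S               ≡⟨ ++-assoc x Q S ⟩
        x ++ Q ++ S                 ≡⟨ cong (_++ Q ++ S) x≡ ⟩
        (G ++ r ++ a ∷ s) ++ Q ++ S ≡⟨ ++-assoc G (r ++ a ∷ s) (Q ++ S) ⟩
        G ++ (r ++ a ∷ s) ++ Q ++ S ∎
      ls-diverges : Diverge _<L_ (concat ls) S
      ls-diverges = subst₂ (Diverge _<L_) (sym ls≡′) (cong (λ u → G ++ u ++ T) (sym ℓ≡))
                  (Diverge-++ˡ G (Diverge-++ʳ (Q ++ S) T (r , s , s′ , a , b , a<b , refl , refl)))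

proposition9p7 :
    (k : ℕ) (w : Word k) → w ≢ [] →
    (L : List (Word k)) → IsCFLin w L →
    (pre ls post : List (Word k)) → L ≡ pre ++ ls ++ post → ls ≢ [] →
    (∀ (m : ℕ) → 1 ≤ m → m < length ls → nth ls m ≥p nth ls (suc m)) →
    ((¬ InverseLyndon (concat ls))
      ⇔
     (length ls > 2 ×
      Σ ℕ λ i → Σ ℕ λ j →
        1 ≤ i × i < j × j < length ls ×
        (∀ (m : ℕ) → 1 ≤ m → m ≤ i → nth ls m ≡ nth ls 1) ×
        nth ls 1 ≢ nth ls (suc i) ×
        nth ls 1 ≥p seg ls i j ×
        ¬ (nth ls 1 ≥p seg ls i (suc j)) ×
        nth ls 1 ≪ seg ls i (suc j) ×
        (Σ (Word k) λ r → Σ (Word k) λ s → Σ (Word k) λ s′ →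
         Σ (Fin k) λ a → Σ (Fin k) λ b →
           a <L b ×
           nth ls 1 ≡ seg ls i j ++ r ++ (a ∷ s) ×
           nth ls (suc j) ≡ r ++ (b ∷ s′))))
proposition9p7 k w _ L (all-antiLyndon , _ , _) pre ls post L≡ ls≢[] chain =
  mk⇔ (obstruction-of-¬inverseLyndon ls ls≢[] ls-antiLyndon (Linked-of-nth ls chain))
      (¬inverseLyndon-of-obstruction ls)
  where
    ls-antiLyndon : All AntiLyndon ls
    ls-antiLyndon = ++⁻ˡ ls (++⁻ʳ pre (subst (All AntiLyndon) L≡ all-antiLyndon))
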